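{- Let $n\ge 1$, $N\ge n$, $I=\{1,\dots,n\}$ and $J=\{n+1,\dots,N\}$, and let sets $\mathcal{E}_i$, $i\in I\cup J$, be defined as follows: $\mathcal{E}_i=\{i\}$ for $i\in I$, and for each $i\in J$ there are indices $i_1,i_2\in I\cup J$ with $i_1,i_2<i$ such that $\mathcal{E}_i=\mathcal{E}_{i_1}\cup\mathcal{E}_{i_2}$. Let $$\mathcal{F}_{\mathcal{E}}=\{x\in\{0,1\}^N:\ x_i\le x_{i_1},\ x_i\le x_{i_2},\ x_i\ge x_{i_1}+x_{i_2}-1,\ x_i\ge 0\ \text{ for all }(i,i_1,i_2)\in J\times(I\cup J)^2 \text{ with } \mathcal{E}_i=\mathcal{E}_{i_1}\cup\mathcal{E}_{i_2}\}.$$ Then every $x\in\mathcal{F}_{\mathcal{E}}$ satisfies: (1) $x_i^2-x_i=0$ for all $i\in I\cup J$; (2) $x_i-x_ix_j=0$ for all $(i,j)\in J\times(I\cup J)$ with $\mathcal{E}_j\subset\mathcal{E}_i$; (3) $x_i-x_jx_k=0$ for all $(i,j,k)\in J\times(I\cup J)^2$ with $\mathcal{E}_i=\mathcal{E}_j\cup\mathcal{E}_k$; (4) $x_ix_j-x_kx_l=0$ for all $(i,j,k,l)\in(I\cup J)^4$ with $\mathcal{E}_i\cup\mathcal{E}_j=\mathcal{E}_k\cup\mathcal{E}_l$.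
   Context: The indices $i\in J$ correspond to auxiliary variables introduced to replace products of two variables: $x_i$ stands for $x_{i_1}x_{i_2}$, so that $\mathcal{E}_i$ is the set of original indices whose product $x_i$ represents. The linear inequalities defining $\mathcal{F}_{\mathcal{E}}$ are the standard (Fortet) linearization inequalities of $x_i=x_{i_1}x_{i_2}$ for binary variables. -}

module Defs where

open import Data.Nat using (ℕ; _≤_; _<_)
open import Data.Fin using (Fin; toℕ; fromℕ<)
open import Data.Fin.Subset using (Subset; ⁅_⁆; _∪_)
open import Data.Integer using (ℤ; 0ℤ; 1ℤ; _+_; _-_; _*_) renaming (_≤_ to _≤ℤ_)
open import Data.Product using (_×_; ∃₂)
open import Data.Sum using (_⊎_)
open import Relation.Binary.PropositionalEquality using (_≡_)

-- Indices of I ∪ J are Fin N; index i (0-based) lies in I iff toℕ i < n,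
-- and in J iff n ≤ toℕ i.  E i is a subset of the original indices Fin n.

ValidE : (n N : ℕ) → (Fin N → Subset n) → Set
ValidE n N E =
  ((i : Fin N) (h : toℕ i < n) → E i ≡ ⁅ fromℕ< h ⁆) ×
  ((i : Fin N) → n ≤ toℕ i →
     ∃₂ λ (i₁ i₂ : Fin N) → toℕ i₁ < toℕ i × toℕ i₂ < toℕ i × E i ≡ E i₁ ∪ E i₂)

Binary : {N : ℕ} → (Fin N → ℤ) → Set
Binary {N} x = (i : Fin N) → x i ≡ 0ℤ ⊎ x i ≡ 1ℤ

InF : (n N : ℕ) → (Fin N → Subset n) → (Fin N → ℤ) → Set
InF n N E x = Binary x ×
  ((i i₁ i₂ : Fin N) → n ≤ toℕ i → E i ≡ E i₁ ∪ E i₂ →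
     (x i ≤ℤ x i₁) × (x i ≤ℤ x i₂) ×
     ((x i₁ + x i₂) - 1ℤ ≤ℤ x i) × (0ℤ ≤ℤ x i))

module Submission where

open import Defs
open import Data.Nat using (ℕ; _≤_; _<?_)
open import Data.Nat.Properties using (≮⇒≥)
open import Data.Fin using (Fin; toℕ; fromℕ<; inject≤; _<_)
open import Data.Fin.Induction using (<-wellFounded)
open import Data.Fin.Properties using (toℕ-injective; toℕ-fromℕ<; toℕ-inject≤)
open import Data.Fin.Subset using (Subset; _∪_; _⊆_; ⁅_⁆; Lift)
open import Data.Fin.Subset.Properties using (x∈⁅x⁆; x∈⁅y⁆⇒x≡y; x∈p∪q⁻; p⊆p∪q; q⊆p∪q)
open import Data.Integer using (ℤ; _+_; _-_; _*_; 0ℤ; 1ℤ; +≤+) renaming (_≤_ to _≤ℤ_)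
open import Data.Integer.Properties using (i≡j⇒i-j≡0)
open import Data.Product using (_×_; _,_; proj₁; proj₂)
open import Data.Product.Function.NonDependent.Propositional using (_×-⇔_)
open import Data.Sum using (_⊎_; inj₁; inj₂)
open import Function.Bundles using (_⇔_; mk⇔; Equivalence)
open import Function.Properties.Equivalence using () renaming (sym to ⇔-sym)
open import Function.Related.Propositional using (module EquationalReasoning)
open import Induction.WellFounded using (Acc; acc)
open import Relation.Nullary using (yes; no)
open import Relation.Binary.PropositionalEquality using (_≡_; refl; sym; trans; cong; subst)

-- Induction along the construction order of the E i shows that, on F_E, x i = 1 exactly when
-- every original variable occurring in the product E i equals 1: the Fortet inequalities force
-- x i = x i₁ ∧ x i₂ for binary values.  So each x i, and each product x i x j, is the {0,1}
-- indicator of a condition on E i (resp. E i ∪ E j) alone, and all four identities follow.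

Bit : ℤ → Set
Bit a = a ≡ 0ℤ ⊎ a ≡ 1ℤ

bit-square : ∀ {a} → Bit a → a * a - a ≡ 0ℤ
bit-square (inj₁ refl) = refl
bit-square (inj₂ refl) = refl

bit-≥1 : ∀ {a} → Bit a → 1ℤ ≤ℤ a → a ≡ 1ℤ
bit-≥1 (inj₁ refl) (+≤+ ())
bit-≥1 (inj₂ refl) _ = refl

bit-≡ : ∀ {a b} → Bit a → Bit b → (a ≡ 1ℤ ⇔ b ≡ 1ℤ) → a ≡ b
bit-≡ (inj₁ refl) (inj₁ refl) _ = refl
bit-≡ (inj₂ refl) (inj₂ refl) _ = refl
bit-≡ (inj₁ refl) (inj₂ refl) a⇔b with Equivalence.from a⇔b refl
... | ()
bit-≡ (inj₂ refl) (inj₁ refl) a⇔b with Equivalence.to a⇔b refl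
... | ()

bit-*≡1⇔ : ∀ {a b} → Bit a → Bit b → a * b ≡ 1ℤ ⇔ (a ≡ 1ℤ × b ≡ 1ℤ)
bit-*≡1⇔ (inj₁ refl) _           = mk⇔ (λ ()) (λ ())
bit-*≡1⇔ (inj₂ refl) (inj₁ refl) = mk⇔ (λ ()) (λ ())
bit-*≡1⇔ (inj₂ refl) (inj₂ refl) = mk⇔ (λ _ → refl , refl) (λ _ → refl)

bit-* : ∀ {a b} → Bit a → Bit b → Bit (a * b)
bit-* (inj₁ refl) _           = inj₁ refl
bit-* (inj₂ refl) (inj₁ refl) = inj₁ refl
bit-* (inj₂ refl) (inj₂ refl) = inj₂ refl

fortet-≡1⇔ : ∀ {a b c} → Bit a → Bit b → Bit c →
             c ≤ℤ a → c ≤ℤ b → (a + b) - 1ℤ ≤ℤ c → c ≡ 1ℤ ⇔ (a ≡ 1ℤ × b ≡ 1ℤ)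
fortet-≡1⇔ {a} {b} bit-a bit-b bit-c c≤a c≤b a+b-1≤c = mk⇔ to from
  where
  to : _ ≡ 1ℤ → a ≡ 1ℤ × b ≡ 1ℤ
  to refl = bit-≥1 bit-a c≤a , bit-≥1 bit-b c≤b
  from : a ≡ 1ℤ × b ≡ 1ℤ → _ ≡ 1ℤ
  from (refl , refl) = bit-≥1 bit-c a+b-1≤c

module _ {n : ℕ} {P : Fin n → Set} where

  Lift-⊆ : {p q : Subset n} → p ⊆ q → Lift P q → Lift P p
  Lift-⊆ p⊆q all e∈p = all (p⊆q e∈p)

  Lift-∪ : (p q : Subset n) → Lift P (p ∪ q) ⇔ (Lift P p × Lift P q)
  Lift-∪ p q = mk⇔ to from
    where
    to : Lift P (p ∪ q) → Lift P p × Lift P q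
    to all = Lift-⊆ (p⊆p∪q q) all , Lift-⊆ (q⊆p∪q p q) all
    from : Lift P p × Lift P q → Lift P (p ∪ q)
    from (all-p , all-q) e∈p∪q with x∈p∪q⁻ p q e∈p∪q
    ... | inj₁ e∈p = all-p e∈p
    ... | inj₂ e∈q = all-q e∈q

  Lift-∪-⊆ : {p q : Subset n} → q ⊆ p → Lift P (p ∪ q) ⇔ Lift P p
  Lift-∪-⊆ {p} {q} q⊆p = mk⇔ (Lift-⊆ (p⊆p∪q q))
    (λ all-p → Equivalence.from (Lift-∪ p q) (all-p , Lift-⊆ q⊆p all-p))

  Lift-⁅⁆ : (i : Fin n) → Lift P ⁅ i ⁆ ⇔ P i
  Lift-⁅⁆ i = mk⇔ (λ all → all (x∈⁅x⁆ i))
    (λ { Pi {_} e∈⁅i⁆ → subst P (sym (x∈⁅y⁆⇒x≡y i e∈⁅i⁆)) Pi })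

module Fortet {n N : ℕ} (n≤N : n ≤ N) (E : Fin N → Subset n) (valid : ValidE n N E)
              (x : Fin N → ℤ) (x∈F : InF n N E x) where

  open EquationalReasoning

  binary : (i : Fin N) → Bit (x i)
  binary = proj₁ x∈F

  Ones : Subset n → Set
  Ones = Lift (λ e → x (inject≤ e n≤N) ≡ 1ℤ)

  x≡1⇔Ones : (i : Fin N) → x i ≡ 1ℤ ⇔ Ones (E i)
  x≡1⇔Ones i = go i (<-wellFounded i)
    where
    go : (i : Fin N) → Acc _<_ i → x i ≡ 1ℤ ⇔ Ones (E i)
    go i _ with toℕ i <? n
    ... | yes i∈I =
      begin
        x i ≡ 1ℤ                 ≡⟨ cong (λ j → x j ≡ 1ℤ) (sym inject≤-fromℕ<) ⟩
        x (inject≤ e n≤N) ≡ 1ℤ   ∼⟨ ⇔-sym (Lift-⁅⁆ e) ⟩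
        Ones ⁅ e ⁆               ≡⟨ cong Ones (sym (proj₁ valid i i∈I)) ⟩
        Ones (E i)               ∎
      where
      e = fromℕ< i∈I
      inject≤-fromℕ< : inject≤ e n≤N ≡ i
      inject≤-fromℕ< = toℕ-injective (trans (toℕ-inject≤ e n≤N) (toℕ-fromℕ< i∈I))
    go i (acc rec) | no i∉I with proj₂ valid i (≮⇒≥ i∉I)
    ... | i₁ , i₂ , i₁<i , i₂<i , Ei≡ with proj₂ x∈F i i₁ i₂ (≮⇒≥ i∉I) Ei≡
    ... | x≤x₁ , x≤x₂ , x₁+x₂-1≤x , _ =
      begin
        x i ≡ 1ℤ                      ∼⟨ fortet-≡1⇔ (binary i₁) (binary i₂) (binary i)
                                                     x≤x₁ x≤x₂ x₁+x₂-1≤x ⟩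
        (x i₁ ≡ 1ℤ × x i₂ ≡ 1ℤ)       ∼⟨ go i₁ (rec i₁<i) ×-⇔ go i₂ (rec i₂<i) ⟩
        (Ones (E i₁) × Ones (E i₂))   ∼⟨ ⇔-sym (Lift-∪ (E i₁) (E i₂)) ⟩
        Ones (E i₁ ∪ E i₂)            ≡⟨ cong Ones (sym Ei≡) ⟩
        Ones (E i)                    ∎

  x*x≡1⇔Ones : (i j : Fin N) → x i * x j ≡ 1ℤ ⇔ Ones (E i ∪ E j)
  x*x≡1⇔Ones i j =
    begin
      x i * x j ≡ 1ℤ                ∼⟨ bit-*≡1⇔ (binary i) (binary j) ⟩
      (x i ≡ 1ℤ × x j ≡ 1ℤ)         ∼⟨ x≡1⇔Ones i ×-⇔ x≡1⇔Ones j ⟩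
      (Ones (E i) × Ones (E j))     ∼⟨ ⇔-sym (Lift-∪ (E i) (E j)) ⟩
      Ones (E i ∪ E j)              ∎

  x≡x*x : (i j : Fin N) → E j ⊆ E i → x i ≡ x i * x j
  x≡x*x i j Ej⊆Ei = bit-≡ (binary i) (bit-* (binary i) (binary j)) (
    begin
      x i ≡ 1ℤ             ∼⟨ x≡1⇔Ones i ⟩
      Ones (E i)           ∼⟨ ⇔-sym (Lift-∪-⊆ Ej⊆Ei) ⟩
      Ones (E i ∪ E j)     ∼⟨ ⇔-sym (x*x≡1⇔Ones i j) ⟩
      x i * x j ≡ 1ℤ       ∎)

  x≡x*x-∪ : (i j k : Fin N) → E i ≡ E j ∪ E k → x i ≡ x j * x k
  x≡x*x-∪ i j k Ei≡ = bit-≡ (binary i) (bit-* (binary j) (binary k)) (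
    begin
      x i ≡ 1ℤ             ∼⟨ x≡1⇔Ones i ⟩
      Ones (E i)           ≡⟨ cong Ones Ei≡ ⟩
      Ones (E j ∪ E k)     ∼⟨ ⇔-sym (x*x≡1⇔Ones j k) ⟩
      x j * x k ≡ 1ℤ       ∎)

  x*x≡x*x : (i j k l : Fin N) → E i ∪ E j ≡ E k ∪ E l → x i * x j ≡ x k * x l
  x*x≡x*x i j k l ∪≡ = bit-≡ (bit-* (binary i) (binary j)) (bit-* (binary k) (binary l)) (
    begin
      x i * x j ≡ 1ℤ       ∼⟨ x*x≡1⇔Ones i j ⟩
      Ones (E i ∪ E j)     ≡⟨ cong Ones ∪≡ ⟩
      Ones (E k ∪ E l)     ∼⟨ ⇔-sym (x*x≡1⇔Ones k l) ⟩
      x k * x l ≡ 1ℤ       ∎)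

lemma1 : (n N : ℕ) → 1 ≤ n → n ≤ N → (E : Fin N → Subset n) → ValidE n N E →
    (x : Fin N → ℤ) → InF n N E x →
    ((i : Fin N) → x i * x i - x i ≡ 0ℤ) ×
    ((i j : Fin N) → n ≤ toℕ i → E j ⊆ E i → x i - x i * x j ≡ 0ℤ) ×
    ((i j k : Fin N) → n ≤ toℕ i → E i ≡ E j ∪ E k → x i - x j * x k ≡ 0ℤ) ×
    ((i j k l : Fin N) → E i ∪ E j ≡ E k ∪ E l → x i * x j - x k * x l ≡ 0ℤ)
lemma1 n N _ n≤N E valid x x∈F =
  (λ i → bit-square (binary i)) ,
  (λ i j _ Ej⊆Ei → i≡j⇒i-j≡0 (x≡x*x i j Ej⊆Ei)) ,
  (λ i j k _ Ei≡ → i≡j⇒i-j≡0 (x≡x*x-∪ i j k Ei≡)) ,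
  (λ i j k l ∪≡ → i≡j⇒i-j≡0 (x*x≡x*x i j k l ∪≡))
  where open Fortet n≤N E valid x x∈F
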